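{- Let $X$ be a symbol-complete and symbol-connected basis and let $f$ be an Arrovian judgment aggregation rule on $X$. Then for every $x,y\in X$, $f_y=f_x$ or $f_y=\mathrm{flip}(f_x)$.
   Context: Fix a finite symbol set; an agenda $\overline{X}$ is a negation-closed set of propositional formulas over it (up to logical equivalence); a basis $X$ contains exactly one of $z,\neg z$ for each $z\in\overline{X}$. Atomic propositions are symbols or negated symbols, others are compound; standing convention: every symbol of a compound proposition is relevant for it. $X$ is symbol-complete if every symbol occurring in $X$ lies in $\overline{X}$; symbol-connected if the graph on $X$ joining propositions sharing a symbol is connected. $\mathbb{U}_X$ is the set of judgments $X\to\{T,F\}$ induced by truth assignments to the symbols. A JAR with $n$ judges is $f\colon\mathbb{U}_X^n\to\mathbb{U}_X$; it is Arrovian if it is unanimity-preserving (unanimous $T$/$F$ on a proposition is preserved) and propositionally independent (for each $z\in X$ there is $f_z\colon\{T,F\}^n\to\{T,F\}$ with $f(p_1,\dots,p_n)(z)=f_z(p_1(z),\dots,p_n(z))$). $\mathrm{flip}(h)(s_1,\dots,s_n)=\neg h(\neg s_1,\dots,\neg s_n)$. -}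

module Defs where

open import Data.Nat using (ℕ)
open import Data.Fin using (Fin)
open import Data.Bool using (Bool; true; false; not; _∧_; _∨_)
open import Data.Vec using (Vec; map)
open import Data.Vec.Relation.Unary.All using (All)
open import Data.Product using (Σ; ∃; _×_)
open import Data.Sum using (_⊎_)
open import Relation.Nullary using (¬_)
open import Relation.Binary.PropositionalEquality using (_≡_; _≢_)
open import Relation.Binary.Construct.Closure.ReflexiveTransitive using (Star)
open import Function.Base using (_∘_)

data Formula (m : ℕ) : Set where
  var  : Fin m → Formula m
  ⊤f   : Formula m
  ⊥f   : Formula m
  neg  : Formula m → Formula m
  _∧f_ : Formula m → Formula m → Formula m
  _∨f_ : Formula m → Formula m → Formula m

Assignment : ℕ → Set
Assignment m = Fin m → Bool

eval : ∀ {m} → Formula m → Assignment m → Bool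
eval (var s)   a = a s
eval ⊤f        a = true
eval ⊥f        a = false
eval (neg p)   a = not (eval p a)
eval (p ∧f q)  a = eval p a ∧ eval q a
eval (p ∨f q)  a = eval p a ∨ eval q a

_≈_ : ∀ {m} → Formula m → Formula m → Set
p ≈ q = ∀ a → eval p a ≡ eval q a

flipAt : ∀ {m} → Fin m → Assignment m → Assignment m
flipAt s a t with Data.Fin._≟_ s t
... | Relation.Nullary.yes _ = not (a t)
... | Relation.Nullary.no  _ = a t
  where open import Data.Fin

-- Symbol s is relevant for p: the truth value of p depends on s.
-- (By the standing convention, the symbols of a proposition are exactly
-- its relevant symbols.)
Relevant : ∀ {m} → Fin m → Formula m → Set
Relevant s p = ∃ λ a → eval p a ≢ eval p (flipAt s a)

-- A basis, given as a finite family of propositions X : Fin k → Formula m;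
-- its agenda is X ∪ ¬X.  Basis condition (up to logical equivalence):
-- the listed propositions are pairwise distinct, and for each z in the
-- agenda exactly one of z, ¬z is in X.
IsBasis : ∀ {m k} → (Fin k → Formula m) → Set
IsBasis {k = k} X =
  (∀ (i j : Fin k) → X i ≈ X j → i ≡ j) ×
  (∀ (i j : Fin k) → ¬ (X i ≈ neg (X j)))

-- Symbol-complete: every symbol occurring in X lies in the agenda.
SymbolComplete : ∀ {m k} → (Fin k → Formula m) → Set
SymbolComplete {k = k} X =
  ∀ (i : Fin k) s → Relevant s (X i) →
    ∃ λ (j : Fin k) → X j ≈ var s ⊎ X j ≈ neg (var s)

ShareSymbol : ∀ {m k} → (Fin k → Formula m) → Fin k → Fin k → Set
ShareSymbol X i j = ∃ λ s → Relevant s (X i) × Relevant s (X j)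

SymbolConnected : ∀ {m k} → (Fin k → Formula m) → Set
SymbolConnected {k = k} X = ∀ (i j : Fin k) → Star (ShareSymbol X) i j

Judgment : ℕ → Set
Judgment k = Fin k → Bool

Induced : ∀ {m k} → (Fin k → Formula m) → Judgment k → Set
Induced X j = ∃ λ a → ∀ i → j i ≡ eval (X i) a

U : ∀ {m k} → (Fin k → Formula m) → Set
U X = Σ (Judgment _) (Induced X)

JAR : ∀ {m k} → (Fin k → Formula m) → ℕ → Set
JAR X n = Vec (U X) n → U X

valueAt : ∀ {m k} (X : Fin k → Formula m) → Fin k → U X → Bool
valueAt X i p = Data.Product.proj₁ p i

UnanimityPreserving : ∀ {m k n} (X : Fin k → Formula m) → JAR X n → Set
UnanimityPreserving {k = k} {n} X f =
  ∀ (ps : Vec (U X) n) (z : Fin k) (b : Bool) →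
    All (λ p → valueAt X z p ≡ b) ps → valueAt X z (f ps) ≡ b

IndependentVia : ∀ {m k n} (X : Fin k → Formula m) → JAR X n →
                 (Fin k → Vec Bool n → Bool) → Set
IndependentVia {k = k} {n} X f fz =
  ∀ (ps : Vec (U X) n) (z : Fin k) → valueAt X z (f ps) ≡ fz z (map (valueAt X z) ps)

PropositionallyIndependent : ∀ {m k n} (X : Fin k → Formula m) → JAR X n → Set
PropositionallyIndependent {k = k} {n} X f =
  Σ (Fin k → Vec Bool n → Bool) (IndependentVia X f)

flip : ∀ {n} → (Vec Bool n → Bool) → Vec Bool n → Bool
flip h s = not (h (map not s))

_≗_ : ∀ {n} → (Vec Bool n → Bool) → (Vec Bool n → Bool) → Set
g ≗ h = ∀ s → g s ≡ h s

module Submission where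

-- Call g a twist of h if g u = p xor h (p xor u) for a polarity p; twist
-- false is the identity and twist true is flip, and "g is a twist of h" is
-- an equivalence relation on functions {T,F}^n → {T,F}.
--
-- Fix an assignment a and a symbol s, and feed f profiles in which every
-- judge uses a with only the value of s changed (pivot profiles).  By
-- unanimity and symbol completeness the collective assignment agrees with
-- a at every relevant symbol other than s, so the collective judgment is
-- governed by a single bit β (its value at s).  Every proposition whose
-- value under a genuinely depends on s -- in particular the literal of s
-- that symbol completeness provides -- then has f_z equal to a twist of β.
-- So propositions sharing a symbol have twisted aggregation functions, and
-- symbol connectedness propagates this along paths to any two propositions.

open import Defs
open import Data.Fin using (Fin; _≟_)
open import Data.Bool using (Bool; true; false; not; _∧_; _∨_; _xor_)
open import Data.Bool.Properties
  using (¬-not; xor-assoc; xor-comm; xor-same; xor-identityʳ) renaming (_≟_ to _≟ᵇ_)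
open import Data.Vec using (Vec; map)
open import Data.Vec.Properties using (map-∘; map-cong; map-id)
open import Data.Vec.Relation.Unary.All using (universal)
open import Data.Vec.Relation.Unary.All.Properties using (map⁺)
open import Data.List using (List; []; _∷_; allFin)
open import Data.List.Relation.Unary.Any using (here; there)
open import Data.List.Membership.Propositional using (_∈_)
open import Data.List.Membership.Propositional.Properties using (∈-allFin)
open import Data.Product using (_×_; _,_; proj₁; proj₂; ∃)
open import Data.Sum using (_⊎_; inj₁; inj₂)
open import Data.Empty using (⊥-elim)
open import Relation.Nullary using (yes; no; ¬_)
open import Relation.Binary.PropositionalEquality
  using (_≡_; _≢_; refl; sym; trans; cong; cong₂; module ≡-Reasoning)
open import Relation.Binary.Construct.Closure.ReflexiveTransitive using (fold)

open ≡-Reasoning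

xor-cancel : ∀ p c → p xor (p xor c) ≡ c
xor-cancel p c = trans (sym (xor-assoc p p c)) (cong (_xor c) (xor-same p))

xor-injective : ∀ p {c d} → p xor c ≡ p xor d → c ≡ d
xor-injective p {c} {d} e = begin
  c                 ≡⟨ sym (xor-cancel p c) ⟩
  p xor (p xor c)   ≡⟨ cong (p xor_) e ⟩
  p xor (p xor d)   ≡⟨ xor-cancel p d ⟩
  d                 ∎

map-xor-xor : ∀ {n} p q (u : Vec Bool n) →
  map (p xor_) (map (q xor_) u) ≡ map ((p xor q) xor_) u
map-xor-xor p q u =
  trans (sym (map-∘ (p xor_) (q xor_) u)) (map-cong (λ c → sym (xor-assoc p q c)) u)

twist : ∀ {n} → Bool → (Vec Bool n → Bool) → Vec Bool n → Bool
twist p h u = p xor h (map (p xor_) u)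

twist-cong : ∀ {n} p {g h : Vec Bool n → Bool} → g ≗ h → twist p g ≗ twist p h
twist-cong p g≗h u = cong (p xor_) (g≗h (map (p xor_) u))

twist-twist : ∀ {n} p q (h : Vec Bool n → Bool) → twist p (twist q h) ≗ twist (p xor q) h
twist-twist p q h u = begin
  p xor (q xor h (map (q xor_) (map (p xor_) u)))  ≡⟨ sym (xor-assoc p q _) ⟩
  (p xor q) xor h (map (q xor_) (map (p xor_) u))  ≡⟨ cong (λ w → (p xor q) xor h w) (map-xor-xor q p u) ⟩
  (p xor q) xor h (map ((q xor p) xor_) u)         ≡⟨ cong (λ r → (p xor q) xor h (map (r xor_) u)) (xor-comm q p) ⟩
  (p xor q) xor h (map ((p xor q) xor_) u)         ∎

twist-false : ∀ {n} (h : Vec Bool n → Bool) → twist false h ≗ h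
twist-false h u = cong h (map-id u)

twist-involutive : ∀ {n} p (h : Vec Bool n → Bool) → twist p (twist p h) ≗ h
twist-involutive p h u = begin
  twist p (twist p h) u  ≡⟨ twist-twist p p h u ⟩
  twist (p xor p) h u    ≡⟨ cong (λ r → twist r h u) (xor-same p) ⟩
  twist false h u        ≡⟨ twist-false h u ⟩
  h u                    ∎

-- g is obtained from h by a twist.  Since twist true is definitionally flip,
-- this is exactly the conclusion of the theorem.
Twisted : ∀ {n} → (Vec Bool n → Bool) → (Vec Bool n → Bool) → Set
Twisted g h = ∃ λ p → g ≗ twist p h

Twisted-refl : ∀ {n} {g : Vec Bool n → Bool} → Twisted g g
Twisted-refl {g = g} = false , λ u → sym (twist-false g u)

Twisted-trans : ∀ {n} {g h k : Vec Bool n → Bool} → Twisted g h → Twisted h k → Twisted g k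
Twisted-trans {k = k} (p , g≗h) (q , h≗k) =
  p xor q , λ u → trans (g≗h u) (trans (twist-cong p h≗k u) (twist-twist p q k u))

twists-of-common : ∀ {n} {g h β : Vec Bool n → Bool} p q →
  g ≗ twist p β → h ≗ twist q β → Twisted h g
twists-of-common {g = g} {β = β} p q g≗ h≗ = q xor p , λ u → begin
  _                          ≡⟨ h≗ u ⟩
  twist q β u                ≡⟨ twist-cong q (λ w → sym (trans (twist-cong p g≗ w) (twist-involutive p β w))) u ⟩
  twist q (twist p g) u      ≡⟨ twist-twist q p g u ⟩
  twist (q xor p) g u        ∎

Twisted⇒equal-or-flip : ∀ {n} {g h : Vec Bool n → Bool} → Twisted g h → (g ≗ h) ⊎ (g ≗ flip h)
Twisted⇒equal-or-flip {h = h} (false , g≗) = inj₁ λ u → trans (g≗ u) (twist-false h u)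
Twisted⇒equal-or-flip (true , g≗)          = inj₂ g≗

nonconstant-xor : (h : Bool → Bool) (b : Bool) → h b ≢ h (not b) → ∀ c → h c ≡ h false xor c
nonconstant-xor h b h-nonconst false = sym (xor-identityʳ (h false))
nonconstant-xor h b h-nonconst true  = trans (swap b h-nonconst) (sym (xor-comm (h false) true))
  where
  swap : ∀ b → h b ≢ h (not b) → h true ≡ not (h false)
  swap true  d = ¬-not d
  swap false d = ¬-not (λ e → d (sym e))

setAt : ∀ {m} → Assignment m → Fin m → Bool → Assignment m
setAt a s b t with s ≟ t
... | yes _ = b
... | no  _ = a t

eval-cong : ∀ {m} (p : Formula m) {a b : Assignment m} → (∀ t → a t ≡ b t) → eval p a ≡ eval p b
eval-cong (var s)  a≐b = a≐b s
eval-cong ⊤f       a≐b = refl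
eval-cong ⊥f       a≐b = refl
eval-cong (neg p)  a≐b = cong not (eval-cong p a≐b)
eval-cong (p ∧f q) a≐b = cong₂ _∧_ (eval-cong p a≐b) (eval-cong q a≐b)
eval-cong (p ∨f q) a≐b = cong₂ _∨_ (eval-cong p a≐b) (eval-cong q a≐b)

setAt-same : ∀ {m} a (s : Fin m) b → setAt a s b s ≡ b
setAt-same a s b with s ≟ s
... | yes _  = refl
... | no s≢s = ⊥-elim (s≢s refl)

setAt-other : ∀ {m} a (s t : Fin m) b → s ≢ t → setAt a s b t ≡ a t
setAt-other a s t b s≢t with s ≟ t
... | yes s≡t = ⊥-elim (s≢t s≡t)
... | no  _   = refl

setAt-unchanged : ∀ {m} a (s : Fin m) {b} → b ≡ a s → ∀ t → setAt a s b t ≡ a t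
setAt-unchanged a s b≡ t with s ≟ t
... | yes refl = b≡
... | no  _    = refl

setAt-flipped : ∀ {m} a (s : Fin m) {b} → b ≡ not (a s) → ∀ t → setAt a s b t ≡ flipAt s a t
setAt-flipped a s b≡ t with s ≟ t
... | yes refl = b≡
... | no  _    = refl

Irrelevant : ∀ {m} → Fin m → Formula m → Set
Irrelevant t p = ∀ a → eval p a ≡ eval p (flipAt t a)

¬Relevant⇒Irrelevant : ∀ {m} {t : Fin m} {p} → ¬ Relevant t p → Irrelevant t p
¬Relevant⇒Irrelevant {t = t} {p} ¬rel a with eval p a ≟ᵇ eval p (flipAt t a)
... | yes e = e
... | no  d = ⊥-elim (¬rel (a , d))

setAt-irrelevant : ∀ {m} {p : Formula m} {u} → Irrelevant u p → ∀ a b → eval p (setAt a u b) ≡ eval p a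
setAt-irrelevant {p = p} {u} irr a b with b ≟ᵇ a u
... | yes b≡ = eval-cong p (setAt-unchanged a u b≡)
... | no  b≢ = trans (eval-cong p (setAt-flipped a u (¬-not b≢))) (sym (irr a))

agree-off-list : ∀ {m} (p : Formula m) (L : List (Fin m)) (a b : Assignment m) →
  (∀ t → a t ≡ b t ⊎ (t ∈ L × Irrelevant t p)) → eval p a ≡ eval p b
agree-off-list p [] a b agree = eval-cong p λ t → on-empty (agree t)
  where
  on-empty : ∀ {t} → a t ≡ b t ⊎ (t ∈ [] × Irrelevant t p) → a t ≡ b t
  on-empty (inj₁ e)        = e
  on-empty (inj₂ (() , _))
agree-off-list p (u ∷ L) a b agree =
  trans (agree-off-list p L a (setAt b u (a u)) agree′) (corrected (agree u))
  where
  agree′ : ∀ t → a t ≡ setAt b u (a u) t ⊎ (t ∈ L × Irrelevant t p)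
  agree′ t with u ≟ t | agree t
  ... | yes refl | _                   = inj₁ refl
  ... | no  u≢t  | inj₁ e              = inj₁ e
  ... | no  u≢t  | inj₂ (here t≡u , _) = ⊥-elim (u≢t (sym t≡u))
  ... | no  u≢t  | inj₂ (there t∈L , irr) = inj₂ (t∈L , irr)
  corrected : a u ≡ b u ⊎ (u ∈ u ∷ L × Irrelevant u p) → eval p (setAt b u (a u)) ≡ eval p b
  corrected (inj₁ e)         = eval-cong p (setAt-unchanged b u e)
  corrected (inj₂ (_ , irr)) = setAt-irrelevant {p = p} {u} irr b (a u)

eval-local : ∀ {m} (p : Formula m) (a b : Assignment m) →
  (∀ t → Relevant t p → a t ≡ b t) → eval p a ≡ eval p b
eval-local {m} p a b agree = agree-off-list p (allFin m) a b classify
  where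
  classify : ∀ t → a t ≡ b t ⊎ (t ∈ allFin m × Irrelevant t p)
  classify t with a t ≟ᵇ b t
  ... | yes e = inj₁ e
  ... | no  d = inj₂ (∈-allFin t , ¬Relevant⇒Irrelevant {t = t} {p} (λ rel → d (agree t rel)))

LiteralOf : ∀ {m} → Fin m → Formula m → Set
LiteralOf t q = ∃ λ p → ∀ a → eval q a ≡ p xor a t

literalOf : ∀ {m} {t : Fin m} {q} → q ≈ var t ⊎ q ≈ neg (var t) → LiteralOf t q
literalOf (inj₁ q≈t)  = false , q≈t
literalOf (inj₂ q≈¬t) = true  , q≈¬t

-- Pivot profiles around the assignment a and the symbol s: every judge uses
-- a, except possibly for the value of s.
module Pivot {m k n} (X : Fin k → Formula m) (complete : SymbolComplete X)
  (f : JAR X n) (fz : Fin k → Vec Bool n → Bool)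
  (unanimous : UnanimityPreserving X f) (independent : IndependentVia X f fz)
  (a : Assignment m) (s : Fin m) where

  pivot : Bool → Assignment m
  pivot c = setAt a s c

  slice : Fin k → Bool → Bool
  slice w c = eval (X w) (pivot c)

  pivotJudgment : Bool → U X
  pivotJudgment c = (λ i → eval (X i) (pivot c)) , pivot c , λ i → refl

  outcome : Vec Bool n → U X
  outcome v = f (map pivotJudgment v)

  outAssign : Vec Bool n → Assignment m
  outAssign v = proj₁ (proj₂ (outcome v))

  β : Vec Bool n → Bool
  β v = outAssign v s

  unanimous-literal : ∀ v {z t} → LiteralOf t (X z) → s ≢ t → outAssign v t ≡ a t
  unanimous-literal v {z} {t} (p , lit) s≢t = xor-injective p (begin
    p xor outAssign v t                  ≡⟨ sym (lit (outAssign v)) ⟩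
    eval (X z) (outAssign v)             ≡⟨ sym (proj₂ (proj₂ (outcome v)) z) ⟩
    valueAt X z (outcome v)              ≡⟨ unanimous _ z (p xor a t) (map⁺ (universal agreed v)) ⟩
    p xor a t                            ∎)
    where
    agreed : ∀ c → valueAt X z (pivotJudgment c) ≡ p xor a t
    agreed c = trans (lit (pivot c)) (cong (p xor_) (setAt-other a s t c s≢t))

  outcome-on-relevant : ∀ v {w t} → Relevant t (X w) → outAssign v t ≡ pivot (β v) t
  -- (pivot (β v) t computes to β v when t = s and to a t otherwise.)
  outcome-on-relevant v {w} {t} rel with s ≟ t
  ... | yes refl = refl
  ... | no  s≢t  = unanimous-literal v (literalOf {q = X _} (proj₂ (complete w t rel))) s≢t

  slice-aggregated : ∀ w v → fz w (map (slice w) v) ≡ slice w (β v)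
  slice-aggregated w v = begin
    fz w (map (slice w) v)                            ≡⟨ cong (fz w) (map-∘ (valueAt X w) pivotJudgment v) ⟩
    fz w (map (valueAt X w) (map pivotJudgment v))    ≡⟨ sym (independent (map pivotJudgment v) w) ⟩
    valueAt X w (outcome v)                           ≡⟨ proj₂ (proj₂ (outcome v)) w ⟩
    eval (X w) (outAssign v)                          ≡⟨ eval-local (X w) _ _ (λ t rel → outcome-on-relevant v rel) ⟩
    slice w (β v)                                     ∎

  twisted-by-pivot : ∀ w p → (∀ c → slice w c ≡ p xor c) → fz w ≗ twist p β
  twisted-by-pivot w p slice≗ u = begin
    fz w u                                   ≡⟨ cong (fz w) (sym (map-xor-cancel u)) ⟩
    fz w (map (p xor_) (map (p xor_) u))     ≡⟨ cong (fz w) (sym (map-cong slice≗ _)) ⟩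
    fz w (map (slice w) (map (p xor_) u))    ≡⟨ slice-aggregated w _ ⟩
    slice w (β (map (p xor_) u))             ≡⟨ slice≗ _ ⟩
    twist p β u                              ∎
    where
    map-xor-cancel : ∀ u → map (p xor_) (map (p xor_) u) ≡ u
    map-xor-cancel u =
      trans (map-xor-xor p p u) (trans (cong (λ r → map (r xor_) u) (xor-same p)) (map-id u))

  dependent-slice : ∀ w → eval (X w) a ≢ eval (X w) (flipAt s a) → ∃ λ p → (∀ c → slice w c ≡ p xor c)
  dependent-slice w depends = slice w false , nonconstant-xor (slice w) (a s) λ e →
    depends (begin
      eval (X w) a                ≡⟨ sym (eval-cong (X w) (setAt-unchanged a s refl)) ⟩
      slice w (a s)               ≡⟨ e ⟩
      slice w (not (a s))         ≡⟨ eval-cong (X w) (setAt-flipped a s refl) ⟩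
      eval (X w) (flipAt s a)     ∎)

  literal-slice : ∀ z → LiteralOf s (X z) → ∃ λ p → (∀ c → slice z c ≡ p xor c)
  literal-slice z (p , lit) = p , λ c → trans (lit (pivot c)) (cong (p xor_) (setAt-same a s c))

  -- A proposition depending on s at a and a literal of s have twisted
  -- aggregation functions, both being twists of β.
  dependent-literal-twisted : ∀ {i z} → eval (X i) a ≢ eval (X i) (flipAt s a) →
    LiteralOf s (X z) → Twisted (fz z) (fz i) × Twisted (fz i) (fz z)
  dependent-literal-twisted {i} {z} depends lit with dependent-slice i depends | literal-slice z lit
  ... | p , slice-i | q , slice-z =
    twists-of-common {β = β} p q fz-i fz-z , twists-of-common {β = β} q p fz-z fz-i
    where
    fz-i : fz i ≗ twist p β
    fz-i = twisted-by-pivot i p slice-i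
    fz-z : fz z ≗ twist q β
    fz-z = twisted-by-pivot z q slice-z

-- Two propositions sharing a symbol s have twisted aggregation functions:
-- both are twisted relative to the literal of s given by symbol completeness.
shared-symbol-twisted : ∀ {m k n} (X : Fin k → Formula m) (complete : SymbolComplete X)
  (f : JAR X n) (fz : Fin k → Vec Bool n → Bool) →
  UnanimityPreserving X f → IndependentVia X f fz →
  ∀ {i j} → ShareSymbol X i j → Twisted (fz j) (fz i)
shared-symbol-twisted X complete f fz unanimous independent {i} {j}
  (s , (a , depends-i) , (b , depends-j)) with complete i s (a , depends-i)
... | z , literal =
  Twisted-trans {k = fz i} (proj₂ (twisted-at b {j} depends-j)) (proj₁ (twisted-at a {i} depends-i))
  where
  twisted-at : ∀ c {w} → eval (X w) c ≢ eval (X w) (flipAt s c) →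
    Twisted (fz z) (fz w) × Twisted (fz w) (fz z)
  twisted-at c depends = Pivot.dependent-literal-twisted X complete f fz unanimous independent c s
                           depends (literalOf {q = X z} literal)

-- Following a path of the symbol graph from x to y composes twists.
corollary3p4 : ∀ {m k n} (X : Fin k → Formula m) → IsBasis X →
    SymbolComplete X → SymbolConnected X →
    (f : JAR X n) (fz : Fin k → Vec Bool n → Bool) →
    UnanimityPreserving X f → IndependentVia X f fz →
    ∀ (x y : Fin k) → (fz y ≗ fz x) ⊎ (fz y ≗ flip (fz x))
corollary3p4 X _ complete connected f fz unanimous independent x y =
  Twisted⇒equal-or-flip
    (fold (λ i j → Twisted (fz j) (fz i)) along-edge Twisted-refl (connected x y))
  where
  along-edge : ∀ {i j l} → ShareSymbol X i j → Twisted (fz l) (fz j) → Twisted (fz l) (fz i)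
  along-edge {i} edge rest =
    Twisted-trans {k = fz i} rest (shared-symbol-twisted X complete f fz unanimous independent edge)
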